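{- Let $G$ be a connected biconvex graph with parts $X$ and $Y$, with convex orderings $\langle x_1,\ldots,x_n\rangle$ of $X$ and $\langle y_1,\ldots,y_m\rangle$ of $Y$ as fixed in the context, and let $(K_1\cup J_1),\ldots,(K_k\cup J_k)$ be the complete bipartite decomposition of $G_p$, so that $\mathrm{dw}(G)=k$. Then $\rho(G) \geq k$. Furthermore, if some $a \in J_1$ satisfies $d_G(x_1,a) \geq 3$, or if $N_G(x_n) \subseteq J_k$, then $\rho(G) \geq k+1$.
   Context: All graphs are finite and simple. $d_G(u,v)$ is the distance in $G$; a packing is a set of vertices with pairwise distance at least $3$, and $\rho(G)$ is the maximum size of a packing. Let $G$ be connected bipartite with parts $X,Y$. An ordering of $X$ is convex if $N_G(y)$ is a set of consecutive vertices in it for every $y\in Y$ (symmetrically for $Y$); $G$ is biconvex if both $X$ and $Y$ admit convex orderings. Given convex orderings $\langle x_1,\ldots,x_n\rangle$ and $\langle y_1,\ldots,y_m\rangle$, let $x_L$ be the smallest vertex of $N(y_1)$ whose neighborhood is not properly contained in the neighborhood of any other vertex, and $x_R$ the largest vertex of $N(y_m)$ with the same property; assume $x_L\le x_R$ (reversing the ordering of $X$ if necessary). Let $X_p=\{x_i : x_L\le x_i\le x_R\}$ and $G_p=G[X_p\cup Y]$. Two orderings $\langle a_1,\ldots\rangle$, $\langle b_1,\ldots\rangle$ of the parts of a bipartite graph are strong if $a_ib_c, a_kb_a\in E$ imply $a_ib_a, a_kb_c\in E$ whenever $i\le k$, $a\le c$. The orderings are fixed so that: (a) $G_p$ is a connected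 bipartite permutation graph; (b) $\langle x_L,\ldots,x_R\rangle$ and $\langle y_1,\ldots,y_m\rangle$ form a strong ordering of $V(G_p)$; (c) for $x_1\le x_i<x_j\le x_L$ or $x_R\le x_j<x_i\le x_n$ we have $N(x_i)\subseteq N(x_j)$ (such orderings exist for every connected biconvex graph). The complete bipartite decomposition of a bipartite permutation graph $H$ with these orderings $A=\langle a_1,\ldots\rangle$ (here $X_p$) and $B=\langle b_1,\ldots\rangle$ (here $Y$) is obtained as follows: $K_1$ is the subgraph induced by $N_H(a_1)\cup N_H(b_1)$, $J_1$ is the set of isolated vertices of $H-K_1$; then repeat on $H-(K_1\cup J_1)$ with the induced orderings until the graph is empty, producing $(K_1\cup J_1),\ldots,(K_k\cup J_k)$. The decomposition width $\mathrm{dw}(G)$ is this number $k$ for $H=G_p$. -}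

module Defs where

open import Level using (0ℓ)
open import Data.Nat using (ℕ; zero; suc) renaming (_<_ to _<ℕ_; _≤_ to _≤ℕ_)
open import Data.Fin using (Fin; _≤_; _<_)
open import Data.Bool using (Bool; T)
open import Data.Sum using (_⊎_; inj₁; inj₂)
open import Data.Product using (Σ; Σ-syntax; ∃; ∃-syntax; _×_; _,_)
open import Data.Empty using (⊥)
open import Data.Unit using (⊤)
open import Data.List using (List; []; _∷_; length)
open import Data.List.Relation.Unary.AllPairs using (AllPairs)
open import Data.Fin.Permutation using (Permutation′; _⟨$⟩ʳ_)
open import Function.Bundles using (_↔_; Inverse; _⇔_)
open import Relation.Nullary using (¬_)

data Walk {V : Set} (adj : V → V → Set) : V → V → ℕ → Set where
  here  : ∀ {u} → Walk adj u u 0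
  there : ∀ {u v w l} → adj u v → Walk adj v w l → Walk adj u w (suc l)

Connected : {V : Set} → (V → V → Set) → Set
Connected {V} adj = (u v : V) → ∃[ l ] Walk adj u v l

DistAtLeast : {V : Set} → (V → V → Set) → V → V → ℕ → Set
DistAtLeast adj u v d = (l : ℕ) → l <ℕ d → ¬ Walk adj u v l

-- A packing: vertices with pairwise distance at least 3 (listed
-- without repetition; distinctness follows from distance ≥ 3).
IsPacking : {V : Set} → (V → V → Set) → List V → Set
IsPacking adj P = AllPairs (λ u v → DistAtLeast adj u v 3) P

PackingNumberAtLeast : {V : Set} → (V → V → Set) → ℕ → Set
PackingNumberAtLeast {V} adj k = Σ[ P ∈ List V ] (IsPacking adj P × k ≤ℕ length P)

IsPermutationGraph : {V : Set} → (V → V → Set) → Set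
IsPermutationGraph {V} adj =
  Σ[ N ∈ ℕ ] Σ[ f ∈ (V ↔ Fin N) ] Σ[ σ ∈ Permutation′ N ]
    ((u v : V) → adj u v ⇔
      ((Inverse.to f u < Inverse.to f v × σ ⟨$⟩ʳ Inverse.to f v < σ ⟨$⟩ʳ Inverse.to f u)
       ⊎ (Inverse.to f v < Inverse.to f u × σ ⟨$⟩ʳ Inverse.to f u < σ ⟨$⟩ʳ Inverse.to f v)))

Induced : {V : Set} → (V → V → Set) → (P : V → Set) → Σ V P → Σ V P → Set
Induced adj P (u , _) (v , _) = adj u v

-- Bipartite graphs with parts X = Fin n and Y = Fin m; the vertex
-- orderings ⟨x_1,…,x_n⟩ and ⟨y_1,…,y_m⟩ are the index orders of Fin.

Vtx : ℕ → ℕ → Set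
Vtx n m = Fin n ⊎ Fin m

module _ {n m : ℕ} (E : Fin n → Fin m → Bool) where

  Adj : Vtx n m → Vtx n m → Set
  Adj (inj₁ x) (inj₂ y) = T (E x y)
  Adj (inj₂ y) (inj₁ x) = T (E x y)
  Adj (inj₁ _) (inj₁ _) = ⊥
  Adj (inj₂ _) (inj₂ _) = ⊥

  ConvexX : Set
  ConvexX = (y : Fin m) (i j k : Fin n) → i ≤ j → j ≤ k →
            T (E i y) → T (E k y) → T (E j y)

  ConvexY : Set
  ConvexY = (x : Fin n) (i j k : Fin m) → i ≤ j → j ≤ k →
            T (E x i) → T (E x k) → T (E x j)

  NbhdSubset : Fin n → Fin n → Set
  NbhdSubset x x' = (y : Fin m) → T (E x y) → T (E x' y)

  NbhdProperSubset : Fin n → Fin n → Set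
  NbhdProperSubset x x' = NbhdSubset x x' × ∃[ y ] (T (E x' y) × ¬ T (E x y))

  -- N(x) is not properly contained in the neighbourhood of any other vertex
  -- (neighbourhoods of vertices of Y lie in X, so only X matters)
  NbhdMaximal : Fin n → Set
  NbhdMaximal x = ¬ (∃[ x' ] NbhdProperSubset x x')

  IsXL : Fin m → Fin n → Set
  IsXL y₁ l = T (E l y₁) × NbhdMaximal l ×
              ((i : Fin n) → i < l → T (E i y₁) → ¬ NbhdMaximal i)

  IsXR : Fin m → Fin n → Set
  IsXR yₘ r = T (E r yₘ) × NbhdMaximal r ×
              ((i : Fin n) → r < i → T (E i yₘ) → ¬ NbhdMaximal i)

  InGp : Fin n → Fin n → Vtx n m → Set
  InGp l r (inj₁ x) = l ≤ x × x ≤ r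
  InGp l r (inj₂ y) = ⊤

  StrongOrdering : Fin n → Fin n → Set
  StrongOrdering l r =
    (i k : Fin n) → l ≤ i → k ≤ r → i ≤ k →
    (a c : Fin m) → a ≤ c →
    T (E i c) → T (E k a) → T (E i a) × T (E k c)

  -- The current graph is G[S] for a vertex predicate S (S ⊆ X_p ∪ Y).
  -- a₁ / b₁ are the first remaining vertices of X / Y in the induced
  -- orderings; K = N_H(a₁) ∪ N_H(b₁) (neighbourhoods in the current
  -- graph), J = isolated vertices of H - K; then recurse on
  -- H - (K ∪ J).

  VPred : Set₁
  VPred = Vtx n m → Set

  PieceK : VPred → Fin n → Fin m → VPred
  PieceK S a₁ b₁ (inj₁ x) = S (inj₁ x) × T (E x b₁)
  PieceK S a₁ b₁ (inj₂ y) = S (inj₂ y) × T (E a₁ y)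

  PieceJ : VPred → Fin n → Fin m → VPred
  PieceJ S a₁ b₁ v =
    S v × ¬ PieceK S a₁ b₁ v ×
    ((w : Vtx n m) → S w → ¬ PieceK S a₁ b₁ w → ¬ Adj v w)

  Remove : VPred → Fin n → Fin m → VPred
  Remove S a₁ b₁ v = S v × ¬ PieceK S a₁ b₁ v × ¬ PieceJ S a₁ b₁ v

  Piece : Set₁
  Piece = VPred × VPred

  data Decomp : VPred → List Piece → Set₁ where
    done : ∀ {S} → ((v : Vtx n m) → ¬ S v) → Decomp S []
    step : ∀ {S ps} (a₁ : Fin n) (b₁ : Fin m) →
           S (inj₁ a₁) → ((x : Fin n) → S (inj₁ x) → a₁ ≤ x) →
           S (inj₂ b₁) → ((y : Fin m) → S (inj₂ y) → b₁ ≤ y) →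
           Decomp (Remove S a₁ b₁) ps →
           Decomp S ((PieceK S a₁ b₁ , PieceJ S a₁ b₁) ∷ ps)

InFirstJ : {n m : ℕ} → List (Σ (Vtx n m → Set) (λ _ → Vtx n m → Set)) → Vtx n m → Set
InFirstJ [] v = ⊥
InFirstJ ((K , J) ∷ _) v = J v

InLastJ : {n m : ℕ} → List (Σ (Vtx n m → Set) (λ _ → Vtx n m → Set)) → Vtx n m → Set
InLastJ [] v = ⊥
InLastJ ((K , J) ∷ []) v = J v
InLastJ (_ ∷ p ∷ ps) v = InLastJ (p ∷ ps) v

module Submission where

-- The packing is x₁ together with one "corner" of each later piece, namely b₂, a₃, b₄, … (the
-- first remaining vertices, alternating between Y and X).  All G_p-neighbours of the corner of
-- piece i lie in K_i, and consecutive corners lie in opposite parts, so they are at distance ≥ 3.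
-- For pieces further apart, convexity and the strong ordering show that K_i ∪ J_i has no edge to
-- anything left after step i + 1; a common neighbour outside X_p can be replaced by x_L or x_R,
-- whose neighbourhoods are larger (property (c)).  Finally N(x₁) ⊆ N(x_L) ⊆ K₁ keeps x₁ away
-- from every corner, and the same arguments handle the extra vertex a ∈ J₁ or x_n.

open import Defs
open import Data.Nat using (ℕ; suc; s≤s; z≤n)
open import Data.Nat.Properties using (<⇒≤; ≰⇒>; ≤-reflexive)
open import Data.Fin as Fin using (Fin; zero; fromℕ; _≤_; _<_)
open import Data.Fin.Properties using (≤-refl; ≤-antisym; <-cmp; _≤?_)
open import Data.Bool using (Bool; T; true; false; not)
open import Data.Bool.Properties using (not-¬)
open import Data.Sum using (_⊎_; inj₁; inj₂)
open import Data.Product using (Σ; Σ-syntax; _×_; _,_; proj₁; proj₂)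
open import Data.List using (List; length; []; _∷_)
open import Data.List.Relation.Unary.All as All using (All; []; _∷_)
open import Data.List.Relation.Unary.AllPairs using ([]; _∷_)
open import Data.Empty using (⊥-elim)
open import Data.Unit using (⊤; tt)
open import Relation.Nullary using (¬_; yes; no)
open import Relation.Nullary.Decidable using (decidable-stable; T?)
open import Relation.Binary.PropositionalEquality using (_≡_; _≢_; refl; sym; subst; cong)
open import Relation.Binary using (tri<; tri≈; tri>)

distAtLeast3 : {V : Set} {adj : V → V → Set} {u v : V} →
               u ≢ v → ¬ adj u v → (∀ w → adj u w → ¬ adj w v) → DistAtLeast adj u v 3
distAtLeast3 u≢v _ _ _ _ here = u≢v refl
distAtLeast3 _ u≁v _ _ _ (there u~v here) = u≁v u~v
distAtLeast3 _ _ no-mid _ _ (there u~w (there w~v here)) = no-mid _ u~w w~v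
distAtLeast3 _ _ _ _ (s≤s (s≤s (s≤s ()))) (there _ (there _ (there _ _)))

module Bipartite {n m : ℕ} (E : Fin n → Fin m → Bool) where

  Far : Vtx n m → Vtx n m → Set
  Far u v = DistAtLeast (Adj E) u v 3

  Adj-sym : ∀ {u v} → Adj E u v → Adj E v u
  Adj-sym {inj₁ _} {inj₂ _} u~v = u~v
  Adj-sym {inj₂ _} {inj₁ _} u~v = u~v

  side : Vtx n m → Bool
  side (inj₁ _) = false
  side (inj₂ _) = true

  no-common-neighbour : ∀ {u v} → side u ≢ side v → ∀ w → Adj E u w → ¬ Adj E w v
  no-common-neighbour {inj₁ _} {inj₁ _} sides = ⊥-elim (sides refl)
  no-common-neighbour {inj₂ _} {inj₂ _} sides = ⊥-elim (sides refl)
  no-common-neighbour {inj₁ _} {inj₂ _} _ (inj₁ _) ()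
  no-common-neighbour {inj₁ _} {inj₂ _} _ (inj₂ _) _ ()
  no-common-neighbour {inj₂ _} {inj₁ _} _ (inj₁ _) _ ()
  no-common-neighbour {inj₂ _} {inj₁ _} _ (inj₂ _) ()

  Detached : Vtx n m → VPred E → Set
  Detached c S = ¬ S c × (∀ w → Adj E c w → ¬ S w)

  detached⇒far-across : ∀ {S c v} → Detached c S → S v → side c ≢ side v → Far c v
  detached⇒far-across (_ , N[c]∉S) v∈S sides =
    distAtLeast3 (λ c≡v → sides (cong side c≡v)) (λ c~v → N[c]∉S _ c~v v∈S)
                 (no-common-neighbour sides)

  corner : Bool → Fin n → Fin m → Vtx n m
  corner true  a b = inj₂ b
  corner false a b = inj₁ a

  side-corner : ∀ q a b → side (corner q a b) ≡ q
  side-corner true  a b = refl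
  side-corner false a b = refl

  corner∈ : ∀ {S : VPred E} q {a b} → S (inj₁ a) → S (inj₂ b) → S (corner q a b)
  corner∈ true  a∈S b∈S = b∈S
  corner∈ false a∈S b∈S = a∈S

  corners : ∀ {S ps} → Decomp E S ps → Bool → List (Vtx n m)
  corners (done _) q = []
  corners (step a b _ _ _ _ d) q = corner q a b ∷ corners d (not q)

  length-corners : ∀ {S ps} (d : Decomp E S ps) q → length (corners d q) ≡ length ps
  length-corners (done _) q = refl
  length-corners (step _ _ _ _ _ _ d) q = cong suc (length-corners d (not q))

  corners⊆ : ∀ {S ps} (d : Decomp E S ps) q → All S (corners d q)
  corners⊆ (done _) q = []
  corners⊆ {S} (step a b a∈S _ b∈S _ d) q =
    corner∈ {S} q a∈S b∈S ∷ All.map proj₁ (corners⊆ d (not q))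

  N-corner⊆K : ∀ {S : VPred E} q a b w → Adj E (corner q a b) w → S w → PieceK E S a b w
  N-corner⊆K true  a b (inj₁ x) b~x x∈S = x∈S , b~x
  N-corner⊆K false a b (inj₂ y) a~y y∈S = y∈S , a~y

  N⊆K⇒detached : ∀ {S : VPred E} a b c →
                 (∀ w → Adj E c w → S w → PieceK E S a b w) → Detached c (Remove E S a b)
  N⊆K⇒detached a b c N[c]⊆K =
    (λ { (c∈S , c∉K , c∉J) → c∉J (c∈S , c∉K , λ w w∈S w∉K c~w → w∉K (N[c]⊆K w c~w w∈S)) }) ,
    (λ { w c~w (w∈S , w∉K , _) → w∉K (N[c]⊆K w c~w w∈S) })

  corner-detached : ∀ {S : VPred E} q a b → Detached (corner q a b) (Remove E S a b)
  corner-detached q a b = N⊆K⇒detached a b (corner q a b) (N-corner⊆K q a b)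

  lastJ-avoids-K : ∀ {S a b ps v} → Decomp E (Remove E S a b) ps →
                   InLastJ ((PieceK E S a b , PieceJ E S a b) ∷ ps) v → S v × ¬ PieceK E S a b v
  lastJ-avoids-K (done _) (v∈S , v∉K , _) = v∈S , v∉K
  lastJ-avoids-K (step _ _ _ _ _ _ d) v∈Jₖ with lastJ-avoids-K d v∈Jₖ
  ... | (v∈S , v∉K , _) , _ = v∈S , v∉K

  J-detached : ∀ {S : VPred E} a b c → PieceJ E S a b c → Detached c (Remove E S a b)
  J-detached a b c c∈J@(_ , _ , c-isolated) =
    (λ { (_ , _ , c∉J) → c∉J c∈J }) ,
    (λ { w c~w (w∈S , w∉K , _) → c-isolated w w∈S w∉K c~w })

module GpDecomposition {n m : ℕ} (E : Fin (suc n) → Fin (suc m) → Bool)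
  (L R : Fin (suc n)) (L≤R : L ≤ R)
  (convX : ConvexX E) (convY : ConvexY E) (strong : StrongOrdering E L R)
  (N⊆N-L : ∀ i → i < L → NbhdSubset E i L)
  (N⊆N-R : ∀ i → R < i → NbhdSubset E i R)
  where

  open Bipartite E

  Gp : VPred E
  Gp = InGp E L R

  L∈Gp : Gp (inj₁ L)
  L∈Gp = ≤-refl , L≤R

  NoIsolated : VPred E → Set
  NoIsolated S = ∀ v → S v → ¬ ¬ (Σ (Vtx (suc n) (suc m)) λ w → S w × Adj E v w)

  Admissible : VPred E → Set
  Admissible S = (∀ v → S v → Gp v) × NoIsolated S

  admissible-Gp : Connected (Induced (Adj E) Gp) → Admissible Gp
  admissible-Gp connGp = (λ _ v∈Gp → v∈Gp) , no-isolated
    where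
    no-isolated : NoIsolated Gp
    no-isolated (inj₁ x) x∈Gp ¬nb with connGp (inj₁ x , x∈Gp) (inj₂ zero , tt)
    ... | _ , there {v = w , w∈Gp} x~w _ = ¬nb (w , w∈Gp , x~w)
    no-isolated (inj₂ y) y∈Gp ¬nb with connGp (inj₂ y , y∈Gp) (inj₁ L , L∈Gp)
    ... | _ , there {v = w , w∈Gp} y~w _ = ¬nb (w , w∈Gp , y~w)

  -- A vertex left without neighbours by the removal of K would have been put into J.
  admissible-Remove : ∀ {S a b} → Admissible S → Admissible (Remove E S a b)
  admissible-Remove (S⊆Gp , no-isolated) =
    (λ v v∈R → S⊆Gp v (proj₁ v∈R)) ,
    λ v (v∈S , v∉K , v∉J) ¬nb → v∉J (v∈S , v∉K , λ w w∈S w∉K v~w →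
      ¬nb (w , (w∈S , w∉K , λ (_ , _ , w-isolated) → w-isolated v v∈S v∉K (Adj-sym {v} {w} v~w)) , v~w))

  record Leaders (S : VPred E) (a : Fin (suc n)) (b : Fin (suc m)) : Set where
    constructor leaders
    field
      a∈ : S (inj₁ a)
      a-min : ∀ x → S (inj₁ x) → a ≤ x
      b∈ : S (inj₂ b)
      b-min : ∀ y → S (inj₂ y) → b ≤ y

  -- a has a neighbour y ≥ b and b a neighbour x ≥ a; the strong ordering gives ab ∈ E.
  leaders-adjacent : ∀ {S a b} → Admissible S → Leaders S a b → T (E a b)
  leaders-adjacent {S} {a} {b} (S⊆Gp , no-isolated) (leaders a∈ a-min b∈ b-min) =
    decidable-stable (T? (E a b)) λ a≁b →
      no-isolated _ a∈ λ
        { (inj₂ y , y∈S , a~y) → no-isolated _ b∈ λ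
            { (inj₁ x , x∈S , x~b) →
                a≁b (proj₁ (strong a x (proj₁ (S⊆Gp _ a∈)) (proj₂ (S⊆Gp _ x∈S)) (a-min x x∈S)
                                   b y (b-min y y∈S) a~y x~b)) } }

  Shielded : VPred E → Fin (suc n) → Fin (suc m) → Set
  Shielded S a b = ∀ w v → Gp w → ¬ S w → Remove E S a b v → ¬ Adj E w v

  -- Comparing the K-vertex with the next leader: if it is smaller, the strong ordering puts its
  -- neighbour into the next K; if larger, convexity puts the next leader itself into K.
  K-shielded : ∀ {S a b a′ b′ w v} → Admissible S →
               Leaders S a b → Leaders (Remove E S a b) a′ b′ →
               PieceK E S a b w → Remove E (Remove E S a b) a′ b′ v → ¬ Adj E w v
  K-shielded {a = a} {b} {a′} {b′} {inj₁ x} {inj₂ y} adm@(S⊆Gp , _) ℓ ℓ′ (x∈S , x~b) (y∈R , y∉K′ , _) x~y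
    with <-cmp x a′ | ℓ′
  ... | tri< x<a′ _ _ | leaders (a′∈S , _) _ _ b′-min =
    y∉K′ (y∈R , proj₂ (strong x a′ (proj₁ (S⊆Gp _ x∈S)) (proj₂ (S⊆Gp _ a′∈S)) (<⇒≤ x<a′)
                              b′ y (b′-min y y∈R) x~y (leaders-adjacent (admissible-Remove adm) ℓ′)))
  ... | tri≈ _ refl _ | leaders (_ , x∉K , _) _ _ _ = x∉K (x∈S , x~b)
  ... | tri> _ _ a′<x | leaders (a′∈S , a′∉K , _) _ _ _ =
    a′∉K (a′∈S , convX b a a′ x (Leaders.a-min ℓ a′ a′∈S) (<⇒≤ a′<x) (leaders-adjacent adm ℓ) x~b)
  K-shielded {a = a} {b} {a′} {b′} {inj₂ y} {inj₁ x} adm@(S⊆Gp , _) ℓ ℓ′ (y∈S , a~y) (x∈R , x∉K′ , _) y~x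
    with <-cmp y b′ | ℓ′
  ... | tri< y<b′ _ _ | leaders (a′∈S , _) a′-min _ _ =
    x∉K′ (x∈R , proj₂ (strong a′ x (proj₁ (S⊆Gp _ a′∈S)) (proj₂ (S⊆Gp _ (proj₁ x∈R))) (a′-min x x∈R)
                              y b′ (<⇒≤ y<b′) (leaders-adjacent (admissible-Remove adm) ℓ′) y~x))
  ... | tri≈ _ refl _ | leaders _ _ (_ , y∉K , _) _ = y∉K (y∈S , a~y)
  ... | tri> _ _ b′<y | leaders _ _ (b′∈S , b′∉K , _) _ =
    b′∉K (b′∈S , convY a b b′ y (Leaders.b-min ℓ b′ b′∈S) (<⇒≤ b′<y) (leaders-adjacent adm ℓ) a~y)

  shielded-step : ∀ {S a b a′ b′} → Admissible S → Shielded S a b →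
                  Leaders S a b → Leaders (Remove E S a b) a′ b′ →
                  Shielded (Remove E S a b) a′ b′
  shielded-step {S} adm shielded ℓ ℓ′ w v w∈Gp w∉R v∈R′@(v∈R@(v∈S , v∉K , _) , _) w~v =
    shielded w v w∈Gp w∉S v∈R w~v
    where
    w∉S : ¬ S w
    w∉S w∈S = w∉R (w∈S , (λ w∈K → K-shielded adm ℓ ℓ′ w∈K v∈R′ w~v) ,
                   λ (_ , _ , w-isolated) → w-isolated v v∈S v∉K w~v)

  ShieldedDecomp : ∀ {S ps} → Decomp E S ps → Set
  ShieldedDecomp (done _) = ⊤
  ShieldedDecomp {S} (step a b _ _ _ _ _) = Shielded S a b

  shielded-next : ∀ {S a b ps} → Admissible S → Shielded S a b → Leaders S a b →
                  (d : Decomp E (Remove E S a b) ps) → ShieldedDecomp d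
  shielded-next adm shielded ℓ (done _) = tt
  shielded-next adm shielded ℓ (step _ _ a′∈ a′-min b′∈ b′-min _) =
    shielded-step adm shielded ℓ (leaders a′∈ a′-min b′∈ b′-min)

  into-Gp : ∀ x → Σ (Fin (suc n)) λ x′ → Gp (inj₁ x′) × NbhdSubset E x x′
  into-Gp x with L ≤? x | x ≤? R
  ... | no L≰x | _        = L , L∈Gp , N⊆N-L x (≰⇒> L≰x)
  ... | yes _  | no x≰R   = R , (L≤R , ≤-refl) , N⊆N-R x (≰⇒> x≰R)
  ... | yes L≤x | yes x≤R = x , (L≤x , x≤R) , λ _ x~y → x~y

  common-neighbour-in-Gp : ∀ {u v} w → Adj E u w → Adj E w v →
                           Σ (Vtx (suc n) (suc m)) λ w′ → Gp w′ × Adj E u w′ × Adj E w′ v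
  common-neighbour-in-Gp (inj₂ y) u~y y~v = inj₂ y , tt , u~y , y~v
  common-neighbour-in-Gp {inj₂ yu} {inj₂ yv} (inj₁ x) yu~x x~yv =
    let x′ , x′∈Gp , N[x]⊆N[x′] = into-Gp x
    in inj₁ x′ , x′∈Gp , N[x]⊆N[x′] yu yu~x , N[x]⊆N[x′] yv x~yv

  far-from-later : ∀ {S a b c v} → Detached c S → Shielded S a b → Remove E S a b v → Far c v
  far-from-later {c = c} (c∉S , N[c]∉S) shielded v∈R@(v∈S , _) =
    distAtLeast3 (λ { refl → c∉S v∈S }) (λ c~v → N[c]∉S _ c~v v∈S)
      λ w c~w w~v → let w′ , w′∈Gp , c~w′ , w′~v = common-neighbour-in-Gp {c} w c~w w~v
                    in shielded w′ _ w′∈Gp (N[c]∉S w′ c~w′) v∈R w′~v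

  far-from-corners : ∀ {S ps c} q → Detached c S → (d : Decomp E S ps) → ShieldedDecomp d →
                     (∀ v → S v → side v ≡ q → Far c v) → All (Far c) (corners d q)
  far-from-corners q detached (done _) _ far-head = []
  far-from-corners {S} q detached (step a b a∈S _ b∈S _ d) shielded far-head =
    far-head _ (corner∈ {S} q a∈S b∈S) (side-corner q a b) ∷
    All.map (far-from-later detached shielded) (corners⊆ d (not q))

  far-from-corners-across : ∀ {S ps c} q → Detached c S → (d : Decomp E S ps) → ShieldedDecomp d →
                            side c ≢ q → All (Far c) (corners d q)
  far-from-corners-across q detached d shielded c≢q =
    far-from-corners q detached d shielded
      λ { v v∈S refl → detached⇒far-across detached v∈S c≢q }

  corners-packing : ∀ {S ps} (d : Decomp E S ps) q → Admissible S → ShieldedDecomp d →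
                    IsPacking (Adj E) (corners d q)
  corners-packing (done _) q _ _ = []
  corners-packing {S} (step a b a∈ a-min b∈ b-min d) q adm shielded =
    far-from-corners-across (not q) (corner-detached {S} q a b) d shielded′ (not-¬ (side-corner q a b)) ∷
    corners-packing d (not q) (admissible-Remove adm) shielded′
    where shielded′ = shielded-next adm shielded (leaders a∈ a-min b∈ b-min) d

  N⊆Jₖ⇒far-from-corners : ∀ {S ps} {p : Piece E} x (d : Decomp E S ps) q → Admissible S →
                          (∀ y → T (E x y) → InLastJ (p ∷ ps) (inj₂ y)) →
                          All (Far (inj₁ x)) (corners d q)
  N⊆Jₖ⇒far-from-corners x (done _) q adm N⊆Jₖ = []
  N⊆Jₖ⇒far-from-corners x (step a b a∈ a-min b∈ b-min d) q adm N⊆Jₖ =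
    far-corner q ∷ N⊆Jₖ⇒far-from-corners x d (not q) (admissible-Remove adm) N⊆Jₖ
    where
    a~b : T (E a b)
    a~b = leaders-adjacent adm (leaders a∈ a-min b∈ b-min)
    N-x∩N-a=∅ : ∀ y → T (E x y) → ¬ T (E a y)
    N-x∩N-a=∅ y x~y a~y = let y∈S , y∉K = lastJ-avoids-K d (N⊆Jₖ y x~y) in y∉K (y∈S , a~y)
    far-corner : ∀ q → Far (inj₁ x) (corner q a b)
    far-corner true =
      distAtLeast3 (λ ()) (λ x~b → N-x∩N-a=∅ b x~b a~b) (no-common-neighbour {inj₁ x} {inj₂ b} (λ ()))
    far-corner false =
      distAtLeast3 (λ { refl → N-x∩N-a=∅ b a~b a~b }) (λ ())
                   (λ { (inj₂ y) x~y y~a → N-x∩N-a=∅ y x~y y~a })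

  module FirstPiece (L-maximal : NbhdMaximal E L) (connGp : Connected (Induced (Adj E) Gp))
                    {a₁ b₁ ps} (ℓ₁ : Leaders Gp a₁ b₁) (d₂ : Decomp E (Remove E Gp a₁ b₁) ps) where

    adm₁ : Admissible Gp
    adm₁ = admissible-Gp connGp

    adm₂ : Admissible (Remove E Gp a₁ b₁)
    adm₂ = admissible-Remove adm₁

    shielded₂ : ShieldedDecomp d₂
    shielded₂ = shielded-next adm₁ (λ _ _ w∈Gp w∉Gp _ _ → w∉Gp w∈Gp) ℓ₁ d₂

    a₁~b₁ : T (E a₁ b₁)
    a₁~b₁ = leaders-adjacent adm₁ ℓ₁

    a₁≡L : a₁ ≡ L
    a₁≡L = ≤-antisym (Leaders.a-min ℓ₁ L L∈Gp) (proj₁ (Leaders.a∈ ℓ₁))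

    N-x₁⊆K₁ : ∀ y → T (E zero y) → PieceK E Gp a₁ b₁ (inj₂ y)
    N-x₁⊆K₁ y x₁~y = tt , subst (λ a → T (E a y)) (sym a₁≡L) (N-zero⊆N L N⊆N-L y x₁~y)
      where
      N-zero⊆N : ∀ l → (∀ i → i < l → NbhdSubset E i l) → NbhdSubset E zero l
      N-zero⊆N zero    _        = λ _ x₁~y → x₁~y
      N-zero⊆N (Fin.suc l) N⊆N-l = N⊆N-l zero (s≤s z≤n)

    x₁-detached : Detached (inj₁ zero) (Remove E Gp a₁ b₁)
    x₁-detached =
      (λ { (x₁∈Gp , x₁∉K₁ , _) →
             x₁∉K₁ (x₁∈Gp , subst (λ a → T (E a b₁)) (≤-antisym (Leaders.a-min ℓ₁ zero x₁∈Gp) z≤n) a₁~b₁) }) ,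
      (λ { (inj₂ y) x₁~y (_ , y∉K₁ , _) → y∉K₁ (N-x₁⊆K₁ y x₁~y) })

    x₁-far-from-corners : All (Far (inj₁ zero)) (corners d₂ true)
    x₁-far-from-corners = far-from-corners-across true x₁-detached d₂ shielded₂ (λ ())

    corners₂-packing : IsPacking (Adj E) (corners d₂ true)
    corners₂-packing = corners-packing d₂ true adm₂ shielded₂

    -- By maximality of N(a₁) = N(x_L): the strong ordering already gives N(a₁) ⊆ N(x).
    K₁-nbhd⊆N-a₁ : ∀ x → Gp (inj₁ x) → T (E x b₁) → NbhdSubset E x a₁
    K₁-nbhd⊆N-a₁ x x∈Gp x~b₁ y x~y =
      decidable-stable (T? (E a₁ y)) λ a₁≁y →
        subst (NbhdMaximal E) (sym a₁≡L) L-maximal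
          (x , (λ y′ a₁~y′ → proj₂ (strong a₁ x (proj₁ a₁∈) (proj₂ x∈Gp) (a₁-min x x∈Gp)
                                            b₁ y′ (b₁-min y′ tt) a₁~y′ x~b₁)) ,
           y , x~y , a₁≁y)
      where open Leaders ℓ₁ renaming (a∈ to a₁∈; a-min to a₁-min; b-min to b₁-min)

    J₁-far-from-corners : ∀ a → PieceJ E Gp a₁ b₁ a → All (Far a) (corners d₂ true)
    J₁-far-from-corners (inj₁ x) x∈J₁ =
      far-from-corners-across true (J-detached a₁ b₁ (inj₁ x) x∈J₁) d₂ shielded₂ (λ ())
    J₁-far-from-corners (inj₂ y) y∈J₁@(_ , _ , y-isolated) =
      far-from-corners true detached d₂ shielded₂ far-from-Y
      where
      detached = J-detached a₁ b₁ (inj₂ y) y∈J₁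
      -- A common neighbour x of y and b is either in K₁, and then N(x) ⊆ N(a₁) puts b into K₁,
      -- or outside K₁, where the J₁-vertex y has no neighbours.
      far-from-Y : ∀ v → Remove E Gp a₁ b₁ v → side v ≡ true → Far (inj₂ y) v
      far-from-Y (inj₂ b) b∈R@(_ , b∉K₁ , _) _ =
        distAtLeast3 (λ { refl → proj₁ detached b∈R }) (λ ()) λ w y~w w~b →
          no-common-neighbour-in-Gp (common-neighbour-in-Gp {inj₂ y} w y~w w~b)
        where
        no-common-neighbour-in-Gp : ¬ (Σ (Vtx (suc n) (suc m)) λ w′ → Gp w′ × Adj E (inj₂ y) w′ × Adj E w′ (inj₂ b))
        no-common-neighbour-in-Gp (inj₁ x , x∈Gp , y~x , x~b) with T? (E x b₁)
        ... | yes x~b₁ = b∉K₁ (tt , K₁-nbhd⊆N-a₁ x x∈Gp x~b₁ b x~b)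
        ... | no x≁b₁  = y-isolated (inj₁ x) x∈Gp (λ x∈K₁ → x≁b₁ (proj₂ x∈K₁)) y~x

    x₁-far-from-xₙ : Connected (Adj E) →
                     (∀ y → T (E (fromℕ n) y) → InLastJ ((PieceK E Gp a₁ b₁ , PieceJ E Gp a₁ b₁) ∷ ps) (inj₂ y)) →
                     Far (inj₁ zero) (inj₁ (fromℕ n))
    x₁-far-from-xₙ connG N⊆Jₖ =
      distAtLeast3 x₁≢xₙ (λ ()) λ { (inj₂ y) x₁~y y~xₙ → N-x₁∩N-xₙ=∅ y x₁~y y~xₙ ; (inj₁ _) () }
      where
      N-x₁∩N-xₙ=∅ : ∀ y → T (E zero y) → ¬ T (E (fromℕ n) y)
      N-x₁∩N-xₙ=∅ y x₁~y xₙ~y = proj₂ (lastJ-avoids-K d₂ (N⊆Jₖ y xₙ~y)) (N-x₁⊆K₁ y x₁~y)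
      x₁≢xₙ : inj₁ zero ≢ inj₁ (fromℕ n)
      x₁≢xₙ x₁≡xₙ with connG (inj₁ zero) (inj₂ zero)
      ... | _ , there {v = inj₂ y} x₁~y _ = N-x₁∩N-xₙ=∅ y x₁~y (subst (λ u → Adj E u (inj₂ y)) x₁≡xₙ x₁~y)

    ρ≥k : PackingNumberAtLeast (Adj E) (suc (length ps))
    ρ≥k = inj₁ zero ∷ corners d₂ true ,
          x₁-far-from-corners ∷ corners₂-packing ,
          ≤-reflexive (cong suc (sym (length-corners d₂ true)))

    ρ≥k+1 : ∀ v → Far (inj₁ zero) v → All (Far v) (corners d₂ true) →
            PackingNumberAtLeast (Adj E) (suc (suc (length ps)))
    ρ≥k+1 v x₁-far-v v-far-from-corners =
      inj₁ zero ∷ v ∷ corners d₂ true ,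
      (x₁-far-v ∷ x₁-far-from-corners) ∷ v-far-from-corners ∷ corners₂-packing ,
      s≤s (≤-reflexive (cong suc (sym (length-corners d₂ true))))

lemma13 : {n m : ℕ} (E : Fin (suc n) → Fin (suc m) → Bool)
          (L R : Fin (suc n)) (ps : List (Piece E)) →
          Connected (Adj E) →
          ConvexX E → ConvexY E →
          IsXL E zero L → IsXR E (fromℕ m) R → L ≤ R →
          Connected (Induced (Adj E) (InGp E L R)) →
          IsPermutationGraph (Induced (Adj E) (InGp E L R)) →
          StrongOrdering E L R →
          ((i j : Fin (suc n)) → i < j → j ≤ L → NbhdSubset E i j) →
          ((i j : Fin (suc n)) → R ≤ j → j < i → NbhdSubset E i j) →
          Decomp E (InGp E L R) ps →
          PackingNumberAtLeast (Adj E) (length ps) ×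
          (((Σ[ a ∈ Vtx (suc n) (suc m) ] (InFirstJ ps a × DistAtLeast (Adj E) (inj₁ zero) a 3))
            ⊎ ((y : Fin (suc m)) → T (E (fromℕ n) y) → InLastJ ps (inj₂ y))) →
           PackingNumberAtLeast (Adj E) (suc (length ps)))
lemma13 E L R _ _ _ _ _ _ _ _ _ _ _ _ (done G-empty) = ⊥-elim (G-empty (inj₂ zero) tt)
lemma13 {n} E L R _ connG convX convY (_ , L-maximal , _) _ L≤R connGp _ strong nested-left nested-right
        (step a₁ b₁ a₁∈ a₁-min b₁∈ b₁-min d₂) =
  ρ≥k ,
  λ { (inj₁ (a , a∈J₁ , x₁-far-a)) → ρ≥k+1 a x₁-far-a (J₁-far-from-corners a a∈J₁)
    ; (inj₂ N⊆Jₖ) → ρ≥k+1 (inj₁ (fromℕ n)) (x₁-far-from-xₙ connG N⊆Jₖ)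
                         (N⊆Jₖ⇒far-from-corners (fromℕ n) d₂ true adm₂ N⊆Jₖ) }
  where
  open GpDecomposition E L R L≤R convX convY strong
         (λ i i<L → nested-left i L i<L ≤-refl) (λ i R<i → nested-right i R ≤-refl R<i)
  open FirstPiece L-maximal connGp (leaders a₁∈ a₁-min b₁∈ b₁-min) d₂
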